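{- The map $S$ is a derivation on the algebra $(\hat{\mathcal F},\cdot)$, that is, \[ S \circ \cdot = \cdot \circ (\operatorname{id} \otimes S + S \otimes \operatorname{id}), \] i.e. $S(u \cdot v) = S(u) \cdot v + u \cdot S(v)$ for $u,v \in \hat{\mathcal F}$. Also, $S(1) = e$ and $S(e) = 0$.
   Context: Let $k$ be a field of characteristic 0 and $\mathcal F = k\langle \mathbf c,\mathbf d\rangle$ the free algebra in non-commuting variables $\mathbf c$ (degree 1) and $\mathbf d$ (degree 2), with concatenation product and unit $1$. Let $\hat{\mathcal F} = k e \oplus \mathcal F$, where $e$ is a formal symbol of degree $-1$; by convention $e v = v e = 0$ under concatenation. The cd-monomials together with $e$ form a basis of $\hat{\mathcal F}$. Coproduct: $\Delta\colon\mathcal F\to\mathcal F\otimes\mathcal F$ is given by $\Delta(1)=0$, $\Delta(\mathbf c)=2(1\otimes 1)$, $\Delta(\mathbf d)=1\otimes\mathbf c+\mathbf c\otimes 1$ and $\Delta(uv)=\Delta(u)v+u\Delta(v)$. Extend to $\hat\Delta\colon\hat{\mathcal F}\to\hat{\mathcal F}\otimes\hat{\mathcal F}$ by $\hat\Delta(e)=e\otimes e$ and $\hat\Delta(u)=\Delta(u)+e\otimes u+u\otimes e$ for $u\in\mathcal F$. Map $\hat G$: let $G\colon\mathcal F\to\mathcal F$ be the linear map with $G(1)=0$, $G(\mathbf c)=\mathbf d$, $G(\mathbf d)=\mathbf c\mathbf d$ and $G(uv)=G(u)v+uG(v)$; define $\hat G\colon\hat{\mathcal F}\to\hat{\mathcal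 F}$ by $\hat G(e)=1$ and $\hat G(u)=G(u)+u\mathbf c$ for $u\in\mathcal F$. Identify $\hat{\mathcal F}$ with its graded dual via the monomial basis ($v\leftrightarrow\delta_v$). The product $\cdot\colon\hat{\mathcal F}\otimes\hat{\mathcal F}\to\hat{\mathcal F}$ (not concatenation) is the transpose of $\hat\Delta$: for monomials $u,v,w$, the coefficient of $w$ in $u\cdot v$ equals the coefficient of $u\otimes v$ in $\hat\Delta(w)$. It is associative with unit $e$; explicitly, writing the monomial $\mathbf c^{m_1}\mathbf d\mathbf c^{m_2}\mathbf d\cdots\mathbf d\mathbf c^{m_k}$ as the list $(m_1,\dots,m_k)$, one has $(M',m)\cdot(n,N') = (M',m-1,n,N')+(M',m,n-1,N')+2(M',m+n+1,N')$, lists with negative entries being zero. The map $S\colon\hat{\mathcal F}\to\hat{\mathcal F}$ is the transpose of $\hat G$: the coefficient of $w$ in $S(v)$ equals the coefficient of $v$ in $\hat G(w)$. -}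

module Defs where

open import Level using (Level; _⊔_)
open import Data.Nat using (ℕ; zero; suc)
open import Data.List using (List; []; _∷_; _++_; map; foldr)
open import Data.List.Membership.Propositional using (_∉_)
open import Data.Product using (Σ; ∃; _×_; _,_)
open import Data.Empty using (⊥)
open import Relation.Nullary using (¬_; yes; no)
open import Relation.Binary.Definitions using (DecidableEquality)
open import Relation.Binary.PropositionalEquality using (_≡_; refl; cong)
import Data.List.Properties as LP
open import Algebra.Bundles using (CommutativeRing)

-- Fields of characteristic 0 (the stdlib has no Field bundle).

module _ {c ℓ : Level} (R : CommutativeRing c ℓ) where
  open CommutativeRing R

  natToRing : ℕ → Carrier
  natToRing zero    = 0#
  natToRing (suc n) = 1# + natToRing n

  record IsFieldChar0 : Set (c ⊔ ℓ) where
    field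
      0≉1      : ¬ (0# ≈ 1#)
      inverse  : ∀ x → ¬ (x ≈ 0#) → Σ Carrier λ y → x * y ≈ 1#
      char0    : ∀ n → natToRing (suc n) ≈ 0# → ⊥

data Letter : Set where
  𝐜 𝐝 : Letter

Word : Set
Word = List Letter

data Mon : Set where
  e : Mon
  w : Word → Mon

_≟L_ : DecidableEquality Letter
𝐜 ≟L 𝐜 = yes refl
𝐜 ≟L 𝐝 = no λ ()
𝐝 ≟L 𝐜 = no λ ()
𝐝 ≟L 𝐝 = yes refl

_≟W_ : DecidableEquality Word
_≟W_ = LP.≡-dec _≟L_

_≟M_ : DecidableEquality Mon
e   ≟M e   = yes refl
e   ≟M w _ = no λ ()
w _ ≟M e   = no λ ()
w u ≟M w v with u ≟W v
... | yes refl = yes refl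
... | no u≢v   = no λ { refl → u≢v refl }

𝟏 : Mon
𝟏 = w []

-- Coproduct Δ on words, as a list of tensor terms (with multiplicity):
-- Δ(1) = 0, Δ(c) = 2 (1⊗1), Δ(d) = 1⊗c + c⊗1, Δ(uv) = Δ(u)v + uΔ(v).

Δ-letter : Letter → List (Word × Word)
Δ-letter 𝐜 = ([] , []) ∷ ([] , []) ∷ []
Δ-letter 𝐝 = ([] , 𝐜 ∷ []) ∷ (𝐜 ∷ [] , []) ∷ []

Δ : Word → List (Word × Word)
Δ []       = []
Δ (x ∷ u)  =
  map (λ { (a , b) → (a , b ++ u) }) (Δ-letter x)
  ++ map (λ { (a , b) → (x ∷ a , b) }) (Δ u)

Δ̂ : Mon → List (Mon × Mon)
Δ̂ e     = (e , e) ∷ []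
Δ̂ (w u) = map (λ { (a , b) → (w a , w b) }) (Δ u) ++ ((e , w u) ∷ (w u , e) ∷ [])

-- G(1) = 0, G(c) = d, G(d) = cd, G(uv) = G(u)v + uG(v);
-- Ĝ(e) = 1, Ĝ(u) = G(u) + u c.

G-letter : Letter → List Word
G-letter 𝐜 = (𝐝 ∷ []) ∷ []
G-letter 𝐝 = (𝐜 ∷ 𝐝 ∷ []) ∷ []

G : Word → List Word
G []      = []
G (x ∷ u) = map (λ a → a ++ u) (G-letter x) ++ map (x ∷_) (G u)

Ĝ : Mon → List Mon
Ĝ e     = w [] ∷ []
Ĝ (w u) = map w (G u) ++ (w (u ++ 𝐜 ∷ []) ∷ [])

-- Elements of F̂ (identified with its graded dual via the monomial
-- basis) are coefficient functions Mon → k with finite support.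

module Algebra {c ℓ : Level} (R : CommutativeRing c ℓ) where
  open CommutativeRing R

  V : Set c
  V = Mon → Carrier

  FinSupp : V → Set ℓ
  FinSupp x = ∃ λ (L : List Mon) → ∀ m → m ∉ L → x m ≈ 0#

  _≐_ : V → V → Set ℓ
  x ≐ y = ∀ m → x m ≈ y m

  _⊕_ : V → V → V
  (x ⊕ y) m = x m + y m

  𝟎 : V
  𝟎 m = 0#

  δ : Mon → V
  δ m m' with m ≟M m'
  ... | yes _ = 1#
  ... | no  _ = 0#

  -- product: transpose of Δ̂.  coeff of m in x·y
  --   = Σ_{(u,v) term of Δ̂ m} x(u) y(v)
  _·_ : V → V → V
  (x · y) m = foldr (λ { (u , v) acc → x u * y v + acc }) 0# (Δ̂ m)

  -- S: transpose of Ĝ.  coeff of m in S x = Σ_{v term of Ĝ m} x(v)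
  S : V → V
  S x m = foldr (λ v acc → x v + acc) 0# (Ĝ m)

-- Transposing, S is a derivation of _·_ exactly when Ĝ is a coderivation of Δ̂:
-- Δ̂ ∘ Ĝ = (Ĝ ⊗ 1 + 1 ⊗ Ĝ) ∘ Δ̂.  Both sides are compared through their transposes,
-- i.e. as sums of an arbitrary f over the tensor terms, which needs only
-- commutative-monoid arithmetic.  On words the identity reads
--   Δ ∘ G + (u ↦ u ⊗ 1) = (G ⊗ 1 + ρ𝐜 ⊗ 1 + 1 ⊗ G) ∘ Δ + (u ↦ 1 ⊗ u),
-- with ρ𝐜 right multiplication by 𝐜; it holds on letters by inspection and propagates
-- along words since Δ and G are both derivations of concatenation.  The e-terms of Δ̂
-- and Ĝ, together with Δ(u𝐜) = Δ(u)𝐜 + 2 u ⊗ 1 (the missing 1 ⊗ ρ𝐜), then give the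
-- coderivation identity for Ĝ.

module Submission where

open import Defs
open import Level using (Level)
open import Function using (_∘_)
open import Data.Product using (_×_; _,_; proj₁; proj₂; uncurry)
open import Data.List using (List; []; _∷_; _++_; [_]; map; foldr)
open import Data.List.Properties using (++-assoc; ++-identityʳ; foldr-map)
import Relation.Binary.PropositionalEquality as ≡
open import Algebra.Bundles using (CommutativeMonoid; CommutativeRing)

module ListSum {c ℓ : Level} (M : CommutativeMonoid c ℓ) where
  open CommutativeMonoid M renaming (_∙_ to _+_; ε to 0#; ∙-cong to +-cong;
    ∙-congˡ to +-congˡ; identityˡ to +-identityˡ; assoc to +-assoc)
  open import Algebra.Properties.CommutativeSemigroup commutativeSemigroup using (interchange)

  -- A foldr, so that S x m and (x · y) m unfold definitionally to sumBy _ (Ĝ m), sumBy _ (Δ̂ m).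
  sumBy : {A : Set} → (A → Carrier) → List A → Carrier
  sumBy g = foldr (λ a acc → g a + acc) 0#

  variable
    A B : Set

  sumBy-map : (g : B → Carrier) (h : A → B) (xs : List A) →
              sumBy g (map h xs) ≡.≡ sumBy (g ∘ h) xs
  sumBy-map g h = foldr-map _ h 0#

  sumBy-++ : (g : A → Carrier) (xs ys : List A) → sumBy g (xs ++ ys) ≈ sumBy g xs + sumBy g ys
  sumBy-++ g []       ys = sym (+-identityˡ _)
  sumBy-++ g (a ∷ xs) ys = trans (+-congˡ (sumBy-++ g xs ys)) (sym (+-assoc _ _ _))

  sumBy-cong : {g h : A → Carrier} → (∀ a → g a ≈ h a) → (xs : List A) → sumBy g xs ≈ sumBy h xs
  sumBy-cong g≈h []       = refl
  sumBy-cong g≈h (a ∷ xs) = +-cong (g≈h a) (sumBy-cong g≈h xs)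

  sumBy-0 : (xs : List A) → sumBy (λ _ → 0#) xs ≈ 0#
  sumBy-0 []       = refl
  sumBy-0 (a ∷ xs) = trans (+-identityˡ _) (sumBy-0 xs)

  sumBy-+ : (g h : A → Carrier) (xs : List A) →
            sumBy (λ a → g a + h a) xs ≈ sumBy g xs + sumBy h xs
  sumBy-+ g h []       = sym (+-identityˡ _)
  sumBy-+ g h (a ∷ xs) = trans (+-congˡ (sumBy-+ g h xs)) (interchange _ _ _ _)

  sumBy-swap : (k : A → B → Carrier) (xs : List A) (ys : List B) →
               sumBy (λ a → sumBy (k a) ys) xs ≈ sumBy (λ b → sumBy (λ a → k a b) xs) ys
  sumBy-swap k []       ys = sym (sumBy-0 ys)
  sumBy-swap k (a ∷ xs) ys = trans (+-congˡ (sumBy-swap k xs ys)) (sym (sumBy-+ (k a) _ ys))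

module Transposes {c ℓ : Level} (M : CommutativeMonoid c ℓ) where
  open CommutativeMonoid M renaming (_∙_ to _+_; ε to 0#; ∙-cong to +-cong;
    ∙-congˡ to +-congˡ; ∙-congʳ to +-congʳ; identityˡ to +-identityˡ;
    identityʳ to +-identityʳ; assoc to +-assoc; comm to +-comm)
  open import Algebra.Solver.CommutativeMonoid M using (solve; _⊜_; id) renaming (_⊕_ to _⊞_)
  open import Relation.Binary.Reasoning.Setoid setoid
  open ListSum M

  Gᵀ : (Word → Carrier) → Word → Carrier
  Gᵀ g u = sumBy g (G u)

  Δᵀ : (Word → Word → Carrier) → Word → Carrier
  Δᵀ f u = sumBy (uncurry f) (Δ u)

  G-letterᵀ : (Word → Carrier) → Letter → Carrier
  G-letterᵀ g x = sumBy g (G-letter x)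

  Δ-letterᵀ : (Word → Word → Carrier) → Letter → Carrier
  Δ-letterᵀ f x = sumBy (uncurry f) (Δ-letter x)

  Gᵀ-∷ : ∀ g x u → Gᵀ g (x ∷ u) ≈ G-letterᵀ (λ h → g (h ++ u)) x + Gᵀ (λ t → g (x ∷ t)) u
  Gᵀ-∷ g x u = trans (sumBy-++ g (map _ (G-letter x)) _)
    (reflexive (≡.cong₂ _+_ (sumBy-map g _ (G-letter x)) (sumBy-map g _ (G u))))

  Δᵀ-∷ : ∀ f x u →
         Δᵀ f (x ∷ u) ≈ Δ-letterᵀ (λ a b → f a (b ++ u)) x + Δᵀ (λ a b → f (x ∷ a) b) u
  Δᵀ-∷ f x u = trans (sumBy-++ (uncurry f) (map _ (Δ-letter x)) _)
    (reflexive (≡.cong₂ _+_ (sumBy-map (uncurry f) _ (Δ-letter x))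
                            (sumBy-map (uncurry f) _ (Δ u))))

  Gᵀ-++ : ∀ g p q → Gᵀ g (p ++ q) ≈ Gᵀ (λ t → g (t ++ q)) p + Gᵀ (λ t → g (p ++ t)) q
  Gᵀ-++ g []      q = sym (+-identityˡ _)
  Gᵀ-++ g (x ∷ p) q = begin
      Gᵀ g (x ∷ (p ++ q))
    ≈⟨ Gᵀ-∷ g x (p ++ q) ⟩
      G-letterᵀ (λ h → g (h ++ (p ++ q))) x + Gᵀ (λ t → g (x ∷ t)) (p ++ q)
    ≈⟨ +-cong (sumBy-cong (λ h → reflexive (≡.cong g (≡.sym (++-assoc h p q)))) (G-letter x))
              (Gᵀ-++ (λ t → g (x ∷ t)) p q) ⟩
      G-letterᵀ (λ h → g ((h ++ p) ++ q)) x
        + (Gᵀ (λ t → g (x ∷ (t ++ q))) p + Gᵀ (λ t → g (x ∷ (p ++ t))) q)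
    ≈⟨ trans (sym (+-assoc _ _ _)) (+-congʳ (sym (Gᵀ-∷ (λ t → g (t ++ q)) x p))) ⟩
      Gᵀ (λ t → g (t ++ q)) (x ∷ p) + Gᵀ (λ t → g (x ∷ (p ++ t))) q
    ∎

  Δᵀ-++ : ∀ f p q → Δᵀ f (p ++ q) ≈ Δᵀ (λ a b → f a (b ++ q)) p + Δᵀ (λ a b → f (p ++ a) b) q
  Δᵀ-++ f []      q = sym (+-identityˡ _)
  Δᵀ-++ f (x ∷ p) q = begin
      Δᵀ f (x ∷ (p ++ q))
    ≈⟨ Δᵀ-∷ f x (p ++ q) ⟩
      Δ-letterᵀ (λ a b → f a (b ++ (p ++ q))) x + Δᵀ (λ a b → f (x ∷ a) b) (p ++ q)
    ≈⟨ +-cong (sumBy-cong (λ r → reflexive (≡.cong (f (proj₁ r)) (≡.sym (++-assoc (proj₂ r) p q))))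
                          (Δ-letter x))
              (Δᵀ-++ (λ a b → f (x ∷ a) b) p q) ⟩
      Δ-letterᵀ (λ a b → f a ((b ++ p) ++ q)) x
        + (Δᵀ (λ a b → f (x ∷ a) (b ++ q)) p + Δᵀ (λ a b → f (x ∷ (p ++ a)) b) q)
    ≈⟨ trans (sym (+-assoc _ _ _)) (+-congʳ (sym (Δᵀ-∷ (λ a b → f a (b ++ q)) x p))) ⟩
      Δᵀ (λ a b → f a (b ++ q)) (x ∷ p) + Δᵀ (λ a b → f (x ∷ (p ++ a)) b) q
    ∎

  -- The transpose of G ⊗ 1 + ρ𝐜 ⊗ 1 + 1 ⊗ G.
  Dᵀ : (Word → Word → Carrier) → Word → Word → Carrier
  Dᵀ f a b = (Gᵀ (λ a' → f a' b) a + f (a ++ [ 𝐜 ]) b) + Gᵀ (f a) b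

  Dᵀ-++ʳ : ∀ f a b u →
           Dᵀ f a (b ++ u) ≈ Dᵀ (λ a' b' → f a' (b' ++ u)) a b + Gᵀ (λ t → f a (b ++ t)) u
  Dᵀ-++ʳ f a b u = trans (+-congˡ (Gᵀ-++ (f a) b u)) (sym (+-assoc _ _ _))

  Dᵀ-∷ˡ : ∀ f x a b →
          Dᵀ f (x ∷ a) b ≈ G-letterᵀ (λ h → f (h ++ a) b) x + Dᵀ (λ a' b' → f (x ∷ a') b') a b
  Dᵀ-∷ˡ f x a b = trans (+-congʳ (trans (+-congʳ (Gᵀ-∷ (λ a' → f a' b) x a)) (+-assoc _ _ _)))
                        (+-assoc _ _ _)

  Gᵀ∘Δᵀ-∷ : ∀ f x u → Gᵀ (Δᵀ f) (x ∷ u) ≈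
    (G-letterᵀ (Δᵀ (λ a b → f a (b ++ u))) x + G-letterᵀ (λ h → Δᵀ (λ a b → f (h ++ a) b) u) x)
    + (Gᵀ (λ v → Δ-letterᵀ (λ a b → f a (b ++ v)) x) u + Gᵀ (Δᵀ (λ a b → f (x ∷ a) b)) u)
  Gᵀ∘Δᵀ-∷ f x u = trans (Gᵀ-∷ (Δᵀ f) x u)
    (+-cong (trans (sumBy-cong (λ h → Δᵀ-++ f h u) (G-letter x)) (sumBy-+ _ _ (G-letter x)))
            (trans (sumBy-cong (λ v → Δᵀ-∷ f x v) (G u)) (sumBy-+ _ _ (G u))))

  Δᵀ∘Dᵀ-∷ : ∀ f x u → Δᵀ (Dᵀ f) (x ∷ u) ≈
    (Δ-letterᵀ (Dᵀ (λ a b → f a (b ++ u))) x + Δ-letterᵀ (λ a b → Gᵀ (λ t → f a (b ++ t)) u) x)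
    + (Δᵀ (λ a b → G-letterᵀ (λ h → f (h ++ a) b) x) u + Δᵀ (Dᵀ (λ a b → f (x ∷ a) b)) u)
  Δᵀ∘Dᵀ-∷ f x u = trans (Δᵀ-∷ (Dᵀ f) x u)
    (+-cong (trans (sumBy-cong (λ r → Dᵀ-++ʳ f (proj₁ r) (proj₂ r) u) (Δ-letter x))
                   (sumBy-+ _ _ (Δ-letter x)))
            (trans (sumBy-cong (λ r → Dᵀ-∷ˡ f x (proj₁ r) (proj₂ r)) (Δ u)) (sumBy-+ _ _ (Δ u))))

  ΔG-exchange-letter : ∀ f x → G-letterᵀ (Δᵀ f) x + f [ x ] [] ≈ Δ-letterᵀ (Dᵀ f) x + f [] [ x ]
  ΔG-exchange-letter f 𝐜 =
    solve 2 (λ p q → (((p ⊞ (q ⊞ id)) ⊞ id) ⊞ q) ⊜ ((((id ⊞ q) ⊞ id) ⊞ (((id ⊞ q) ⊞ id) ⊞ id)) ⊞ p))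
      refl (f [] [ 𝐜 ]) (f [ 𝐜 ] [])
  ΔG-exchange-letter f 𝐝 =
    solve 4 (λ p q r s → (((p ⊞ (p ⊞ (q ⊞ (r ⊞ id)))) ⊞ id) ⊞ s)
                         ⊜ ((((id ⊞ q) ⊞ (p ⊞ id)) ⊞ ((((s ⊞ id) ⊞ r) ⊞ id) ⊞ id)) ⊞ p))
      refl (f [] [ 𝐝 ]) (f [ 𝐜 ] [ 𝐜 ]) (f (𝐜 ∷ 𝐜 ∷ []) []) (f [ 𝐝 ] [])

  ΔG-exchange : ∀ f u → Gᵀ (Δᵀ f) u + f u [] ≈ Δᵀ (Dᵀ f) u + f [] u
  ΔG-exchange f []      = refl
  ΔG-exchange f (x ∷ u) = begin
      Gᵀ (Δᵀ f) (x ∷ u) + f (x ∷ u) []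
    ≈⟨ +-congʳ (Gᵀ∘Δᵀ-∷ f x u) ⟩
      ((P₁ + P₂) + (P₃ + P₄)) + f (x ∷ u) []
    ≈⟨ solve 5 (λ p₁ p₂ p₃ p₄ z → (((p₁ ⊞ p₂) ⊞ (p₃ ⊞ p₄)) ⊞ z) ⊜ ((p₂ ⊞ p₃) ⊞ ((p₄ ⊞ z) ⊞ p₁)))
         refl P₁ P₂ P₃ P₄ _ ⟩
      (P₂ + P₃) + ((P₄ + f (x ∷ u) []) + P₁)
    ≈⟨ +-cong (+-cong (sumBy-swap _ (G-letter x) (Δ u)) (sumBy-swap _ (G u) (Δ-letter x)))
              (+-congʳ (ΔG-exchange fₓ u)) ⟩
      (Q₂ + Q₃) + ((Δᵀ (Dᵀ fₓ) u + f [ x ] u) + P₁)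
    ≈⟨ +-congˡ (trans (+-assoc _ _ _) (+-congˡ (trans (+-comm _ _) (ΔG-exchange-letter fᵘ x)))) ⟩
      (Q₂ + Q₃) + (Δᵀ (Dᵀ fₓ) u + (Q₁ + f [] (x ∷ u)))
    ≈⟨ solve 5 (λ q₁ q₂ q₃ d z → ((q₂ ⊞ q₃) ⊞ (d ⊞ (q₁ ⊞ z))) ⊜ (((q₁ ⊞ q₃) ⊞ (q₂ ⊞ d)) ⊞ z))
         refl Q₁ Q₂ Q₃ _ _ ⟩
      ((Q₁ + Q₃) + (Q₂ + Δᵀ (Dᵀ fₓ) u)) + f [] (x ∷ u)
    ≈⟨ +-congʳ (sym (Δᵀ∘Dᵀ-∷ f x u)) ⟩
      Δᵀ (Dᵀ f) (x ∷ u) + f [] (x ∷ u)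
    ∎
    where
    fᵘ fₓ : Word → Word → Carrier
    fᵘ a b = f a (b ++ u)
    fₓ a b = f (x ∷ a) b
    P₁ = G-letterᵀ (Δᵀ fᵘ) x
    P₂ = G-letterᵀ (λ h → Δᵀ (λ a b → f (h ++ a) b) u) x
    P₃ = Gᵀ (λ v → Δ-letterᵀ (λ a b → f a (b ++ v)) x) u
    P₄ = Gᵀ (Δᵀ fₓ) u
    Q₁ = Δ-letterᵀ (Dᵀ fᵘ) x
    Q₂ = Δᵀ (λ a b → G-letterᵀ (λ h → f (h ++ a) b) x) u
    Q₃ = Δ-letterᵀ (λ a b → Gᵀ (λ t → f a (b ++ t)) u) x

  Ĝᵀ : (Mon → Carrier) → Mon → Carrier
  Ĝᵀ g m = sumBy g (Ĝ m)

  Δ̂ᵀ : (Mon → Mon → Carrier) → Mon → Carrier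
  Δ̂ᵀ f m = sumBy (uncurry f) (Δ̂ m)

  Ĝᵀ-w : ∀ g u → Ĝᵀ g (w u) ≈ Gᵀ (g ∘ w) u + g (w (u ++ [ 𝐜 ]))
  Ĝᵀ-w g u = trans (sumBy-++ g (map w (G u)) _)
    (+-cong (reflexive (sumBy-map g w (G u))) (+-identityʳ _))

  Δ̂ᵀ-w : ∀ f u → Δ̂ᵀ f (w u) ≈ Δᵀ (λ a b → f (w a) (w b)) u + (f e (w u) + f (w u) e)
  Δ̂ᵀ-w f u = trans (sumBy-++ (uncurry f) (map _ (Δ u)) _)
    (+-cong (reflexive (sumBy-map (uncurry f) _ (Δ u))) (+-congˡ (+-identityʳ _)))

  Δᵀ-∷ʳ-𝐜 : ∀ f u → Δᵀ f (u ++ [ 𝐜 ]) ≈ Δᵀ (λ a b → f a (b ++ [ 𝐜 ])) u + (f u [] + f u [])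
  Δᵀ-∷ʳ-𝐜 f u = trans (Δᵀ-++ f u [ 𝐜 ])
    (+-congˡ (trans (reflexive (≡.cong (λ v → f v [] + (f v [] + 0#)) (++-identityʳ u)))
                    (+-congˡ (+-identityʳ _))))

  Gᵀ-vanishes : ∀ g → (∀ x t → g (x ∷ t) ≈ 0#) → ∀ u → Gᵀ g u ≈ 0#
  Gᵀ-vanishes g g≈0 []      = refl
  Gᵀ-vanishes g g≈0 (x ∷ u) = trans (Gᵀ-∷ g x u)
    (trans (+-cong (first-term x) (trans (sumBy-cong (g≈0 x) (G u)) (sumBy-0 (G u))))
           (+-identityˡ 0#))
    where
    first-term : ∀ x → G-letterᵀ (λ h → g (h ++ u)) x ≈ 0#
    first-term 𝐜 = trans (+-identityʳ _) (g≈0 𝐝 u)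
    first-term 𝐝 = trans (+-identityʳ _) (g≈0 𝐜 (𝐝 ∷ u))

  Ĝᵀ-w-vanishes : ∀ g → (∀ x t → g (w (x ∷ t)) ≈ 0#) → ∀ u → Ĝᵀ g (w u) ≈ 0#
  Ĝᵀ-w-vanishes g g≈0 u =
    trans (Ĝᵀ-w g u) (trans (+-cong (Gᵀ-vanishes (g ∘ w) g≈0 u) (last-term u)) (+-identityˡ 0#))
    where
    last-term : ∀ u → g (w (u ++ [ 𝐜 ])) ≈ 0#
    last-term []      = g≈0 𝐜 []
    last-term (x ∷ u) = g≈0 x (u ++ [ 𝐜 ])

  Ĝ-coderivation : ∀ f m → Ĝᵀ (Δ̂ᵀ f) m ≈ Δ̂ᵀ (λ a b → Ĝᵀ (λ a' → f a' b) a + Ĝᵀ (f a) b) m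
  Ĝ-coderivation f e =
    solve 2 (λ p q → ((p ⊞ (q ⊞ id)) ⊞ id) ⊜ (((q ⊞ id) ⊞ (p ⊞ id)) ⊞ id)) refl (f e 𝟏) (f 𝟏 e)
  Ĝ-coderivation f (w u) = begin
      Ĝᵀ (Δ̂ᵀ f) (w u)
    ≈⟨ lhs-expansion ⟩
      (Gᵀ (Δᵀ F) u + (Sₑ + S'ₑ)) + ((Δᵀ F𝐜 u + (F u [] + F u [])) + (Eₑ + E'ₑ))
    ≈⟨ solve 8 (λ x sₑ s'ₑ y z eₑ e'ₑ t →
                  ((x ⊞ (sₑ ⊞ s'ₑ)) ⊞ ((y ⊞ (z ⊞ z)) ⊞ (eₑ ⊞ e'ₑ)))
                  ⊜ ((x ⊞ z) ⊞ ((sₑ ⊞ s'ₑ) ⊞ ((y ⊞ z) ⊞ (eₑ ⊞ e'ₑ)))))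
         refl (Gᵀ (Δᵀ F) u) Sₑ S'ₑ (Δᵀ F𝐜 u) (F u []) Eₑ E'ₑ (F [] u) ⟩
      (Gᵀ (Δᵀ F) u + F u []) + ((Sₑ + S'ₑ) + ((Δᵀ F𝐜 u + F u []) + (Eₑ + E'ₑ)))
    ≈⟨ +-congʳ (ΔG-exchange F u) ⟩
      (Δᵀ (Dᵀ F) u + F [] u) + ((Sₑ + S'ₑ) + ((Δᵀ F𝐜 u + F u []) + (Eₑ + E'ₑ)))
    ≈⟨ solve 8 (λ x sₑ s'ₑ y z eₑ e'ₑ t →
                  ((x ⊞ t) ⊞ ((sₑ ⊞ s'ₑ) ⊞ ((y ⊞ z) ⊞ (eₑ ⊞ e'ₑ))))
                  ⊜ ((x ⊞ y) ⊞ (((t ⊞ id) ⊞ (sₑ ⊞ eₑ)) ⊞ ((s'ₑ ⊞ e'ₑ) ⊞ (z ⊞ id)))))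
         refl (Δᵀ (Dᵀ F) u) Sₑ S'ₑ (Δᵀ F𝐜 u) (F u []) Eₑ E'ₑ (F [] u) ⟩
      (Δᵀ (Dᵀ F) u + Δᵀ F𝐜 u) + (((F [] u + 0#) + (Sₑ + Eₑ)) + ((S'ₑ + E'ₑ) + (F u [] + 0#)))
    ≈⟨ sym rhs-expansion ⟩
      Δ̂ᵀ (λ a b → Ĝᵀ (λ a' → f a' b) a + Ĝᵀ (f a) b) (w u)
    ∎
    where
    F F𝐜 : Word → Word → Carrier
    F a b = f (w a) (w b)
    F𝐜 a b = F a (b ++ [ 𝐜 ])
    Sₑ = Gᵀ (λ v → f e (w v)) u
    S'ₑ = Gᵀ (λ v → f (w v) e) u
    Eₑ = f e (w (u ++ [ 𝐜 ]))
    E'ₑ = f (w (u ++ [ 𝐜 ])) e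

    lhs-expansion : Ĝᵀ (Δ̂ᵀ f) (w u)
      ≈ (Gᵀ (Δᵀ F) u + (Sₑ + S'ₑ)) + ((Δᵀ F𝐜 u + (F u [] + F u [])) + (Eₑ + E'ₑ))
    lhs-expansion = trans (Ĝᵀ-w (Δ̂ᵀ f) u)
      (+-cong (trans (sumBy-cong (λ v → Δ̂ᵀ-w f v) (G u))
                     (trans (sumBy-+ _ _ (G u)) (+-congˡ (sumBy-+ _ _ (G u)))))
              (trans (Δ̂ᵀ-w f (u ++ [ 𝐜 ])) (+-congʳ (Δᵀ-∷ʳ-𝐜 F u))))

    rhs-expansion : Δ̂ᵀ (λ a b → Ĝᵀ (λ a' → f a' b) a + Ĝᵀ (f a) b) (w u)
      ≈ (Δᵀ (Dᵀ F) u + Δᵀ F𝐜 u) + (((F [] u + 0#) + (Sₑ + Eₑ)) + ((S'ₑ + E'ₑ) + (F u [] + 0#)))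
    rhs-expansion = trans (Δ̂ᵀ-w _ u)
      (+-cong (trans (sumBy-cong (λ r → trans (+-cong (Ĝᵀ-w _ (proj₁ r)) (Ĝᵀ-w _ (proj₂ r)))
                                                (sym (+-assoc _ _ _)))
                                 (Δ u))
                     (sumBy-+ _ _ (Δ u)))
              (+-cong (+-congˡ (Ĝᵀ-w (f e) u)) (+-congʳ (Ĝᵀ-w (λ a' → f a' e) u))))

module Derivation {c ℓ : Level} (R : CommutativeRing c ℓ) where
  open CommutativeRing R
  open import Relation.Binary.Reasoning.Setoid setoid
  open Algebra R
  open ListSum +-commutativeMonoid
  open Transposes +-commutativeMonoid

  sumBy-*ʳ : {A : Set} (g : A → Carrier) (xs : List A) (z : Carrier) →
             sumBy g xs * z ≈ sumBy (λ a → g a * z) xs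
  sumBy-*ʳ g []       z = zeroˡ z
  sumBy-*ʳ g (a ∷ xs) z = trans (distribʳ z _ _) (+-congˡ (sumBy-*ʳ g xs z))

  sumBy-*ˡ : {A : Set} (g : A → Carrier) (xs : List A) (z : Carrier) →
             z * sumBy g xs ≈ sumBy (λ a → z * g a) xs
  sumBy-*ˡ g []       z = zeroʳ z
  sumBy-*ˡ g (a ∷ xs) z = trans (distribˡ z _ _) (+-congˡ (sumBy-*ˡ g xs z))

  S-derivation : (x y : V) → S (x · y) ≐ ((S x · y) ⊕ (x · S y))
  S-derivation x y m = begin
      S (x · y) m
    ≈⟨ Ĝ-coderivation (λ a b → x a * y b) m ⟩
      Δ̂ᵀ (λ a b → Ĝᵀ (λ a' → x a' * y b) a + Ĝᵀ (λ b' → x a * y b') b) m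
    ≈⟨ sumBy-cong (λ r → +-cong (sym (sumBy-*ʳ x (Ĝ (proj₁ r)) _))
                                (sym (sumBy-*ˡ y (Ĝ (proj₂ r)) _)))
                  (Δ̂ m) ⟩
      Δ̂ᵀ (λ a b → Ĝᵀ x a * y b + x a * Ĝᵀ y b) m
    ≈⟨ sumBy-+ _ _ (Δ̂ m) ⟩
      (S x · y) m + (x · S y) m
    ∎

  S-δ𝟏 : S (δ 𝟏) ≐ δ e
  S-δ𝟏 e     = +-identityʳ 1#
  S-δ𝟏 (w u) = Ĝᵀ-w-vanishes (δ 𝟏) (λ _ _ → refl) u

  S-δe : S (δ e) ≐ 𝟎
  S-δe e     = +-identityˡ 0#
  S-δe (w u) = Ĝᵀ-w-vanishes (δ e) (λ _ _ → refl) u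

theorem3p1 : {c ℓ : Level} (k : CommutativeRing c ℓ) → IsFieldChar0 k →
    let open Algebra k in
    ((x y : V) → FinSupp x → FinSupp y →
      S (x · y) ≐ ((S x · y) ⊕ (x · S y)))
    × (S (δ 𝟏) ≐ δ e)
    × (S (δ e) ≐ 𝟎)
theorem3p1 k _ = (λ x y _ _ → S-derivation x y) , S-δ𝟏 , S-δe
  where open Derivation k
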